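{- Let $H$ be a pseudoexpander, $M$ a pseudomatching of $H$, and $S$ a set of literals with $Vars(S)=V(H)\setminus\bigcup M$ that is $1$-comfortable with respect to $M$ (i.e. $S$ falsifies no clause of $\phi_H$ and respects every pseudoedge of $M$). Then for every $\varphi\in{\bf CNF}(M)$, $Pr({\bf ES}(\varphi)\mid{\bf EC}(S))=(2/3)^{|M|}$.
   Context: Binary-tree-based graph: $H$ is an edge-disjoint union of extended rooted trees (no leaf has a sibling) $T_1,\dots,T_m$ with roots $t_1,\dots,t_m$, each vertex that is a leaf of some $T_i$ is a leaf of exactly two trees, and any two trees share at most one vertex, a leaf of both. Root variables are roots, leaf variables are leaves of the trees, internal variables the others (each in exactly one tree); internal vertices are siblings if they lie in the same $T_i$ and are siblings there. If $T_i,T_j$ share a leaf $\ell_{i,j}$, $\{t_i,t_j\}$ is a pseudoedge; $P^{1/2}_{i\to j}$ is the path in $T_i$ from $t_i$ to $\ell_{i,j}$ and $P_{i,j}$ the path from $t_i$ to $t_j$ in $T_i\cup T_j$. A pseudomatching $M$ is a set of pseudoedges with pairwise disjoint ends; $\bigcup M$ is the set of ends. $H$ is a pseudoexpander if every tree has height (max number of vertices on a root–leaf path) $\le(\log_2 m)/4.9+3$ and any two disjoint root sets of size $\ge m^{0.999}$ admit a pseudomatching of size $\ge m^{0.999}/3$ with each pseudoedge having one end in each set. $\phi_H$: monotone CNF over $V(H)$ with one clause $C_{i,j}=\bigvee_{v\in V(P_{i,j})}v$ per pseudoedge. ${\bf CNF}(M)$: CNFs with, for each $\{t_i,t_j\}\in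 M$, exactly one clause equal to $\bigvee_{v\in V(P^{1/2}_{i\to j})}v$ or $\bigvee_{v\in V(P^{1/2}_{j\to i})}v$. Sets of literals never contain a variable with its negation. $S$ falsifies a clause if all its variables occur negatively in $S$. $S$ respects $\{t_i,t_j\}$ if all non-root variables of $C_{i,j}$ occur negatively in $S$ and all siblings of internal variables of $C_{i,j}$ occur positively in $S$. $Fix(S)$: positive literals $\ell_{i,j}\in S$ with all other variables of $C_{i,j}$ negative in $S$. Probability space on ${\bf SAT}(H)$ (sets of literals over all of $V(H)$ satisfying $\phi_H$) with $Pr(\{S\})=2^{ -|S\setminus Fix(S)|}$. ${\bf EC}(S)=\{S'\in{\bf SAT}(H):S\subseteq S'\}$, ${\bf ES}(\varphi)=\{S'\in{\bf SAT}(H):S'\text{ satisfies }\varphi\}$. -}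

module Defs where

open import Data.Bool using (Bool; true; false; _∧_; _∨_; not; if_then_else_)
open import Data.Nat as ℕ using (ℕ; zero; suc; _∸_; _^_; _≤_; _<_)
open import Data.Fin using (Fin; toℕ; _≟_)
open import Data.Fin.Subset using (Subset; ∣_∣) renaming (_∈_ to _∈ₛ_; _∉_ to _∉ₛ_)
open import Data.Integer using (+_)
open import Data.List as L using (List; []; _∷_; length; allFin; concatMap; filter)
open import Data.Bool.ListAction using (any; all)
open import Data.List.Relation.Unary.All using (All)
open import Data.List.Relation.Unary.Unique.Propositional using (Unique)
open import Data.List.Relation.Binary.Pointwise using (Pointwise)
open import Data.List.Membership.Propositional using (_∈_)
open import Data.Maybe using (Maybe; just; nothing)
open import Data.Product using (Σ; ∃; _×_; _,_; proj₁; proj₂; swap)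
open import Data.Sum using (_⊎_)
open import Data.Rational as ℚ using (ℚ; 0ℚ; 1ℚ; ½; _/_)
import Data.Vec.Functional as VF
open import Function using (id; _∘_)
open import Relation.Binary.PropositionalEquality using (_≡_; _≢_)
open import Relation.Nullary using (¬_)
open import Relation.Nullary.Decidable using (⌊_⌋)

-- Vertices (= variables) are Fin n, trees T_1..T_m are indexed by Fin m.
-- Tree i has vertex set {v | inT i v ≡ true}, root (root i), and parent
-- map (par i); its edges are {v , par i v} for v ≠ root i in T_i.
-- Convention: par i (root i) ≡ root i (enforced in WellFormed).

record BTG : Set where
  field
    n      : ℕ
    m      : ℕ
    root   : Fin m → Fin n
    inT    : Fin m → Fin n → Bool
    par    : Fin m → Fin n → Fin n

module _ (H : BTG) where
  open BTG H

  InT : Fin m → Fin n → Set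
  InT i v = inT i v ≡ true

  iter : Fin m → ℕ → Fin n → Fin n
  iter i zero    v = v
  iter i (suc k) v = par i (iter i k v)

  IsLeaf : Fin m → Fin n → Set
  IsLeaf i v = InT i v × v ≢ root i × (∀ w → InT i w → w ≢ root i → par i w ≢ v)

  TreeSib : Fin m → Fin n → Fin n → Set
  TreeSib i v w = InT i v × InT i w × v ≢ root i × w ≢ root i × v ≢ w × par i v ≡ par i w

  IsRootVar : Fin n → Set
  IsRootVar v = ∃ λ i → v ≡ root i

  IsLeafVar : Fin n → Set
  IsLeafVar v = ∃ λ i → IsLeaf i v

  IsInternal : Fin n → Set
  IsInternal v = ¬ IsRootVar v × ¬ IsLeafVar v

  Sib : Fin n → Fin n → Set
  Sib v w = IsInternal v × IsInternal w × ∃ λ i → TreeSib i v w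

  WellFormed : Set
  WellFormed =
      (∀ i → InT i (root i))
    × (∀ i → par i (root i) ≡ root i)
    × (∀ i v → InT i v → InT i (par i v))
    × (∀ i v → InT i v → ∃ λ k → iter i k v ≡ root i)
    × (∀ v → ∃ λ i → InT i v)
    × (∀ i v w → IsLeaf i v → ¬ TreeSib i v w)
    × (∀ i v → IsLeaf i v →
         ∃ λ j → j ≢ i × IsLeaf j v × (∀ k → IsLeaf k v → k ≡ i ⊎ k ≡ j))
    × (∀ i j → i ≢ j → ∀ v w → InT i v → InT j v → InT i w → InT j w → v ≡ w)
    × (∀ i j → i ≢ j → ∀ v → InT i v → InT j v → IsLeaf i v × IsLeaf j v)
    × (∀ i j → i ≢ j → ∀ v w → InT i v → v ≢ root i → InT j w → w ≢ root j →   -- edge-disjoint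
         ¬ ((v ≡ w × par i v ≡ par j w) ⊎ (v ≡ par j w × par i v ≡ w)))

  PE : Fin m → Fin m → Set
  PE i j = i ≢ j × ∃ λ v → InT i v × InT j v

  ends : List (Fin m × Fin m) → List (Fin m)
  ends = concatMap (λ e → proj₁ e ∷ proj₂ e ∷ [])

  -- pseudomatching, as a list of (ordered representatives of) pseudoedges
  IsPM : List (Fin m × Fin m) → Set
  IsPM M = All (λ e → PE (proj₁ e) (proj₂ e)) M × Unique (ends M)

  -- height: every root-leaf path (k+1 vertices) satisfies
  -- k+1 ≤ log₂ m / 4.9 + 3, written as 2^(49·(k+1-3)) ≤ m^10
  HeightOK : Set
  HeightOK = ∀ i v → IsLeaf i v → ∀ k → iter i k v ≡ root i →
               (∀ j → j < k → iter i j v ≢ root i) →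
               2 ^ (49 ℕ.* (suc k ∸ 3)) ≤ m ^ 10

  -- |A| ≥ m^0.999 written as m^999 ≤ |A|^1000
  ExpanderOK : Set
  ExpanderOK = ∀ (A B : Subset m) → (∀ i → i ∈ₛ A → i ∉ₛ B) →
                 m ^ 999 ≤ ∣ A ∣ ^ 1000 → m ^ 999 ≤ ∣ B ∣ ^ 1000 →
                 ∃ λ M → IsPM M
                   × All (λ e → (proj₁ e ∈ₛ A × proj₂ e ∈ₛ B) ⊎ (proj₁ e ∈ₛ B × proj₂ e ∈ₛ A)) M
                   × m ^ 999 ≤ (3 ℕ.* length M) ^ 1000

  IsPseudoexpander : Set
  IsPseudoexpander = WellFormed × HeightOK × ExpanderOK

  anyFin : ∀ {k} → (Fin k → Bool) → Bool
  anyFin {k} p = any p (allFin k)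

  allFin? : ∀ {k} → (Fin k → Bool) → Bool
  allFin? {k} p = all p (allFin k)

  eqᵇ : ∀ {k} → Fin k → Fin k → Bool
  eqᵇ a b = ⌊ a ≟ b ⌋

  -- v lies on the path of T_i from ℓ up to the root (paths have < n edges)
  ancᵇ : Fin m → Fin n → Fin n → Bool
  ancᵇ i ℓ v = anyFin {n} (λ k → eqᵇ (iter i (toℕ k) ℓ) v)

  sharedᵇ : Fin m → Fin m → Fin n → Bool
  sharedᵇ i j v = inT i v ∧ inT j v

  isPEᵇ : Fin m → Fin m → Bool
  isPEᵇ i j = not (eqᵇ i j) ∧ anyFin (sharedᵇ i j)

  halfᵇ : Fin m → Fin m → Fin n → Bool
  halfᵇ i j v = anyFin (λ ℓ → sharedᵇ i j ℓ ∧ ancᵇ i ℓ v)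

  clauseᵇ : Fin m → Fin m → Fin n → Bool
  clauseᵇ i j v = halfᵇ i j v ∨ halfᵇ j i v

  Assignment : Set
  Assignment = Fin n → Bool          -- a set of literals over all of V(H)

  PartialAssignment : Set
  PartialAssignment = Fin n → Maybe Bool   -- a set of literals (no complementary pair)

  satHᵇ : Assignment → Bool
  satHᵇ σ = allFin? (λ i → allFin? (λ j →
              not (isPEᵇ i j) ∨ anyFin (λ v → clauseᵇ i j v ∧ σ v)))

  fixᵇ : Assignment → Fin n → Bool
  fixᵇ σ v = σ v ∧ anyFin (λ i → anyFin (λ j →
               isPEᵇ i j ∧ sharedᵇ i j v ∧
               allFin? (λ w → not (clauseᵇ i j w) ∨ eqᵇ w v ∨ not (σ w))))

  countFix : Assignment → ℕ
  countFix σ = length (filter (λ v → fixᵇ σ v ≡? true) (allFin n))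
    where
      open import Data.Bool.Properties using () renaming (_≟_ to _≡?_)

halfPow : ℕ → ℚ
halfPow zero    = 1ℚ
halfPow (suc k) = ½ ℚ.* halfPow k

twoThirdsPow : ℕ → ℚ
twoThirdsPow zero    = 1ℚ
twoThirdsPow (suc k) = (+ 2 / 3) ℚ.* twoThirdsPow k

allAssign : ∀ k → List (Fin k → Bool)
allAssign zero    = (λ ()) ∷ []
allAssign (suc k) = concatMap (λ f → (false VF.∷ f) ∷ (true VF.∷ f) ∷ []) (allAssign k)

sumℚ : List ℚ → ℚ
sumℚ = L.foldr ℚ._+_ 0ℚ

module _ (H : BTG) where
  open BTG H

  -- Pr({σ}) = 2^{-|σ \ Fix(σ)|}, and |σ| = n
  weight : Assignment H → ℚ
  weight σ = halfPow (n ∸ countFix H σ)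

  Pr : (Assignment H → Bool) → ℚ
  Pr A = sumℚ (L.map (λ σ → if satHᵇ H σ ∧ A σ then weight σ else 0ℚ) (allAssign n))

  ECᵇ : PartialAssignment H → Assignment H → Bool
  ECᵇ S σ = allFin? H (λ v → agree (S v) (σ v))
    where
      agree : Maybe Bool → Bool → Bool
      agree nothing  _ = true
      agree (just b) c = ⌊ b Data.Bool.≟ c ⌋
        where import Data.Bool

  -- ES(φ): φ given as a list of oriented pairs (i , j), the clause
  -- ⋁ V(P^{1/2}_{i→j})
  ESᵇ : List (Fin m × Fin m) → Assignment H → Bool
  ESᵇ φ σ = all (λ e → anyFin H (λ v → halfᵇ H (proj₁ e) (proj₂ e) v ∧ σ v)) φ

  InCNF : List (Fin m × Fin m) → List (Fin m × Fin m) → Set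
  InCNF M φ = Pointwise (λ e d → d ≡ e ⊎ d ≡ swap e) M φ

  InUM : List (Fin m × Fin m) → Fin n → Set
  InUM M v = ∃ λ e → e ∈ M × (v ≡ root (proj₁ e) ⊎ v ≡ root (proj₂ e))

  NoFalsified : PartialAssignment H → Set
  NoFalsified S = ∀ i j → PE H i j →
                    ¬ (∀ v → clauseᵇ H i j v ≡ true → S v ≡ just false)

  Respects : PartialAssignment H → Fin m → Fin m → Set
  Respects S i j =
      (∀ v → clauseᵇ H i j v ≡ true → ¬ IsRootVar H v → S v ≡ just false)
    × (∀ v w → clauseᵇ H i j v ≡ true → IsInternal H v → Sib H v w → S w ≡ just true)

  Comfortable1 : List (Fin m × Fin m) → PartialAssignment H → Set
  Comfortable1 M S = NoFalsified S × All (λ e → Respects S (proj₁ e) (proj₂ e)) M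

-- Inside EC(S) only the roots in ⋃M are free, and S already decides every clause of φ_H
-- except the clauses of M: a clause C_{i,j} with both roots assigned is settled by S because
-- S falsifies no clause, and one whose root t_i is matched to t_p ≠ t_j contains the sibling,
-- set true by S, of the vertex where P^{1/2}_{i→p} leaves P^{1/2}_{i→j}. So on EC(S) the formula
-- φ_H reduces to ⋀_{{t_i,t_j}∈M} (t_i ∨ t_j), a half clause of φ ∈ CNF(M) reduces to its root,
-- and Fix(σ), hence Pr({σ}), is the same for every σ ∈ EC(S). Summing out the disjoint root
-- pairs one at a time, each pair contributes a factor 3 to Pr(EC(S)) and 2 to Pr(ES(φ) ∩ EC(S)).

module Submission where

open import Defs
open import Algebra.Bundles using (CommutativeMonoid)
open import Data.Bool using (Bool; true; false; not; _∧_; _∨_; if_then_else_)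
open import Data.Bool.ListAction using (any; all)
open import Data.Bool.Properties
  using (T-≡; ¬-not; ∨-comm; ∧-zeroʳ; ∧-identityʳ; ∧-conicalˡ; ∧-conicalʳ; not-involutive)
import Data.Bool.Properties as Bool
open import Data.Fin as Fin using (Fin; zero; suc; toℕ)
import Data.Fin.Properties as Fin
import Data.Integer as ℤ
open import Data.List using (List; []; _∷_; map; concatMap; length; filter; allFin)
open import Data.List.Properties using (map-cong)
open import Data.List.Membership.Propositional using (_∈_; _∉_; lose)
open import Data.List.Membership.Propositional.Properties using (∈-allFin; ∈-map⁺; ∈-map⁻)
open import Data.List.Relation.Binary.Pointwise using ([]; _∷_)
open import Data.List.Relation.Unary.Any using (here; there; satisfied)
open import Data.List.Relation.Unary.Any.Properties using (any⁺; any⁻)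
import Data.List.Relation.Unary.All as All
open import Data.List.Relation.Unary.All.Properties using (all⁺; all⁻)
open import Data.List.Relation.Unary.AllPairs using (_∷_)
open import Data.List.Relation.Unary.Unique.Propositional using (Unique)
open import Data.List.Relation.Unary.Unique.Propositional.Properties using (map⁺; Unique[x∷xs]⇒x∉xs)
open import Data.Maybe using (just; nothing; fromMaybe)
open import Data.Nat as ℕ using (ℕ; zero; suc; _∸_)
import Data.Nat.Properties as ℕ
open import Data.Nat.Induction using (<-rec)
open import Data.Product using (∃; _×_; _,_; proj₁; proj₂; map₂)
open import Data.Rational using (ℚ; 0ℚ; 1ℚ; ½; _+_; _*_; _/_; _≤_; _<_; positive)
import Data.Rational.Properties as ℚ
open import Data.Sum as Sum using (_⊎_; inj₁; inj₂)
open import Data.Vec.Functional as V using (Vector; updateAt)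
open import Data.Vec.Functional.Properties using (updateAt-updates; updateAt-minimal; updateAt-cong-local)
open import Function using (_∘_; const; _⇔_; Equivalence)
open import Relation.Binary.PropositionalEquality
open import Relation.Nullary using (¬_; yes; no; contradiction)
open import Relation.Nullary.Decidable using (⌊_⌋)
open import Algebra.Properties.CommutativeSemigroup
  (CommutativeMonoid.commutativeSemigroup ℚ.+-0-commutativeMonoid) using () renaming (interchange to +-interchange)
open import Algebra.Properties.CommutativeSemigroup
  (CommutativeMonoid.commutativeSemigroup ℚ.*-1-commutativeMonoid) using () renaming (interchange to *-interchange)

private
  variable
    k : ℕ

-- Boolean reasoning

∧-true : ∀ {a b} → a ∧ b ≡ true → a ≡ true × b ≡ true
∧-true {true} e = refl , e

∨-true : ∀ {a b} → a ∨ b ≡ true → a ≡ true ⊎ b ≡ true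
∨-true {true}  e = inj₁ refl
∨-true {false} e = inj₂ e

∨-trueʳ : ∀ a {b} → b ≡ true → a ∨ b ≡ true
∨-trueʳ true  _ = refl
∨-trueʳ false e = e

bool-ext : ∀ {a b} → (a ≡ true → b ≡ true) → (b ≡ true → a ≡ true) → a ≡ b
bool-ext {true}          a⇒b _   = sym (a⇒b refl)
bool-ext {false} {true}  _   b⇒a = b⇒a refl
bool-ext {false} {false} _   _   = refl

∧-absorbʳ : ∀ {b c} → (c ≡ true → b ≡ true) → b ∧ c ≡ c
∧-absorbʳ {b} {true}  c⇒b = cong (_∧ true) (c⇒b refl)
∧-absorbʳ {b} {false} _   = ∧-zeroʳ b

all-cong : ∀ {A : Set} {p q : A → Bool} xs → (∀ {x} → x ∈ xs → p x ≡ q x) → all p xs ≡ all q xs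
all-cong []       p≡q = refl
all-cong (x ∷ xs) p≡q = cong₂ _∧_ (p≡q (here refl)) (all-cong xs (p≡q ∘ there))

all-intro : ∀ {A : Set} (p : A → Bool) xs → (∀ {x} → x ∈ xs → p x ≡ true) → all p xs ≡ true
all-intro p xs holds = Equivalence.to T-≡ (all⁻ p (All.tabulate (Equivalence.from T-≡ ∘ holds)))

all-false-witness : ∀ {A : Set} (p : A → Bool) xs → all p xs ≡ false → ∃ λ x → p x ≡ false
all-false-witness p (x ∷ xs) e with p x in px
... | false = x , px
... | true  = all-false-witness p xs e

anyFin-witness : (p : Fin k → Bool) → any p (allFin k) ≡ true → ∃ λ x → p x ≡ true
anyFin-witness {k} p e = map₂ (Equivalence.to T-≡) (satisfied (any⁻ p (allFin k) (Equivalence.from T-≡ e)))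

anyFin-intro : (p : Fin k → Bool) (x : Fin k) → p x ≡ true → any p (allFin k) ≡ true
anyFin-intro p x e = Equivalence.to T-≡ (any⁺ p (lose (∈-allFin x) (Equivalence.from T-≡ e)))

anyFin-false : (p : Fin k → Bool) → any p (allFin k) ≡ false → ∀ x → p x ≡ false
anyFin-false p e x = ¬-not λ px → contradiction (trans (sym (anyFin-intro p x px)) e) λ ()

allFin-elim : (p : Fin k → Bool) → all p (allFin k) ≡ true → ∀ x → p x ≡ true
allFin-elim {k} p e x = Equivalence.to T-≡ (All.lookup (all⁺ p (allFin k) (Equivalence.from T-≡ e)) (∈-allFin x))

allFin-intro : (p : Fin k → Bool) → (∀ x → p x ≡ true) → all p (allFin k) ≡ true
allFin-intro {k} p holds = all-intro p (allFin k) (λ {x} _ → holds x)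

eqᵇ-≡ : ∀ {a b : Fin k} → ⌊ a Fin.≟ b ⌋ ≡ true → a ≡ b
eqᵇ-≡ {a = a} {b} e with a Fin.≟ b
... | yes a≡b = a≡b

eqᵇ-refl : (a : Fin k) → ⌊ a Fin.≟ a ⌋ ≡ true
eqᵇ-refl a with a Fin.≟ a
... | yes _  = refl
... | no a≢a = contradiction refl a≢a

eqᵇ-≢ : ∀ {a b : Fin k} → a ≢ b → ⌊ a Fin.≟ b ⌋ ≡ false
eqᵇ-≢ {a = a} {b} a≢b with a Fin.≟ b
... | yes a≡b = contradiction a≡b a≢b
... | no _    = refl

length-filter-cong : ∀ {A : Set} {f g : A → Bool} xs → (∀ x → f x ≡ g x) →
                     length (filter (λ x → f x Bool.≟ true) xs) ≡ length (filter (λ x → g x Bool.≟ true) xs)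
length-filter-cong         []       f≗g = refl
length-filter-cong {g = g} (x ∷ xs) f≗g rewrite f≗g x with g x
... | true  = cong suc (length-filter-cong xs f≗g)
... | false = length-filter-cong xs f≗g

least : (p : ℕ → Bool) → ∀ t → p t ≡ true → ∃ λ s → p s ≡ true × (∀ r → r ℕ.< s → p r ≡ false)
least p zero    pt = 0 , pt , λ _ ()
least p (suc t) pt with p 0 in p0
... | true  = 0 , p0 , λ _ ()
... | false with least (p ∘ suc) t pt
...   | s , ps , below = suc s , ps , λ { zero _ → p0 ; (suc r) r<s → below r (ℕ.s<s⁻¹ r<s) }

-- Sums over Boolean vectors

_when_ : ℚ → Bool → ℚ
x when b = if b then x else 0ℚ

when-∧ : ∀ x b c → x when (b ∧ c) ≡ (x when c) when b
when-∧ x false c = refl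
when-∧ x true  c = refl

when-true : ∀ {x b} → b ≡ true → x when b ≡ x
when-true refl = refl

when-false : ∀ {x b} → b ≡ false → x when b ≡ 0ℚ
when-false refl = refl

when-comm : ∀ x b c → (x when b) when c ≡ (x when c) when b
when-comm x false false = refl
when-comm x false true  = refl
when-comm x true  false = refl
when-comm x true  true  = refl

when-+ : ∀ x y b → x when b + y when b ≡ (x + y) when b
when-+ x y false = ℚ.+-identityʳ 0ℚ
when-+ x y true  = refl

when-split : ∀ x b → x ≡ x when not b + x when b
when-split x false = sym (ℚ.+-identityʳ x)
when-split x true  = sym (ℚ.+-identityˡ x)

when-* : ∀ x b → x when b ≡ (1ℚ when b) * x
when-* x false = sym (ℚ.*-zeroˡ x)
when-* x true  = sym (ℚ.*-identityˡ x)

0-when : ∀ b → 0ℚ when b ≡ 0ℚ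
0-when false = refl
0-when true  = refl

𝟙 : Bool → ℚ
𝟙 b = 1ℚ when b

count : (Bool → Bool → Bool) → ℚ
count g = (𝟙 (g false false) + 𝟙 (g true false)) + (𝟙 (g false true) + 𝟙 (g true true))

when-count : ∀ g x → (x when g false false + x when g true false) + (x when g false true + x when g true true)
                     ≡ count g * x
when-count g x = begin
  (x when p + x when q) + (x when r + x when s)
    ≡⟨ cong₂ _+_ (cong₂ _+_ (when-* x p) (when-* x q)) (cong₂ _+_ (when-* x r) (when-* x s)) ⟩
  (𝟙 p * x + 𝟙 q * x) + (𝟙 r * x + 𝟙 s * x)
    ≡⟨ cong₂ _+_ (ℚ.*-distribʳ-+ x (𝟙 p) (𝟙 q)) (ℚ.*-distribʳ-+ x (𝟙 r) (𝟙 s)) ⟨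
  (𝟙 p + 𝟙 q) * x + (𝟙 r + 𝟙 s) * x
    ≡⟨ ℚ.*-distribʳ-+ x (𝟙 p + 𝟙 q) (𝟙 r + 𝟙 s) ⟨
  count g * x ∎
  where
  open ≡-Reasoning
  p q r s : Bool
  p = g false false
  q = g true false
  r = g false true
  s = g true true

module _ {A : Set} where

  sum-map-+ : ∀ (F G : A → ℚ) xs →
              sumℚ (map (λ x → F x + G x) xs) ≡ sumℚ (map F xs) + sumℚ (map G xs)
  sum-map-+ F G []       = sym (ℚ.+-identityʳ 0ℚ)
  sum-map-+ F G (x ∷ xs) = begin
    (F x + G x) + sumℚ (map (λ x → F x + G x) xs)  ≡⟨ cong ((F x + G x) +_) (sum-map-+ F G xs) ⟩
    (F x + G x) + (sumℚ (map F xs) + sumℚ (map G xs)) ≡⟨ +-interchange (F x) (G x) _ _ ⟩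
    (F x + sumℚ (map F xs)) + (G x + sumℚ (map G xs)) ∎
    where
    open ≡-Reasoning

  sum-map-* : ∀ c (F : A → ℚ) xs → sumℚ (map (λ x → c * F x) xs) ≡ c * sumℚ (map F xs)
  sum-map-* c F []       = sym (ℚ.*-zeroʳ c)
  sum-map-* c F (x ∷ xs) = trans (cong (c * F x +_) (sum-map-* c F xs))
                                 (sym (ℚ.*-distribˡ-+ c (F x) _))

-- Opaque, so that unification sees ∑ F rather than the list fold it unfolds to.
opaque
  ∑ : (Vector Bool k → ℚ) → ℚ
  ∑ {k} F = sumℚ (map F (allAssign k))

  ∑-unfold : (F : Vector Bool k → ℚ) → ∑ F ≡ sumℚ (map F (allAssign k))
  ∑-unfold F = refl

  ∑-cong : {F G : Vector Bool k → ℚ} → (∀ σ → F σ ≡ G σ) → ∑ F ≡ ∑ G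
  ∑-cong {k} F≗G = cong sumℚ (map-cong F≗G (allAssign k))

  ∑-+ : (F G : Vector Bool k → ℚ) → ∑ (λ σ → F σ + G σ) ≡ ∑ F + ∑ G
  ∑-+ {k} F G = sum-map-+ F G (allAssign k)

  ∑-* : ∀ c (F : Vector Bool k → ℚ) → ∑ (λ σ → c * F σ) ≡ c * ∑ F
  ∑-* {k} c F = sum-map-* c F (allAssign k)

  ∑-suc : (F : Vector Bool (suc k) → ℚ) → ∑ F ≡ ∑ (λ σ → F (false V.∷ σ) + F (true V.∷ σ))
  ∑-suc {k} F = go (allAssign k)
    where
    go : ∀ σs → sumℚ (map F (concatMap (λ σ → (false V.∷ σ) ∷ (true V.∷ σ) ∷ []) σs))
              ≡ sumℚ (map (λ σ → F (false V.∷ σ) + F (true V.∷ σ)) σs)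
    go []       = refl
    go (σ ∷ σs) = trans (sym (ℚ.+-assoc (F (false V.∷ σ)) (F (true V.∷ σ)) _))
                        (cong (F (false V.∷ σ) + F (true V.∷ σ) +_) (go σs))

  ∑-zero : (F : Vector Bool zero → ℚ) → ∑ F ≡ F (λ ()) + 0ℚ
  ∑-zero F = refl

Extensional : {B : Set} → (Vector Bool k → B) → Set
Extensional F = ∀ {σ τ} → σ ≗ τ → F σ ≡ F τ

when-extensional : {F : Vector Bool k → ℚ} {P : Vector Bool k → Bool} →
                   Extensional F → Extensional P → Extensional (λ σ → F σ when P σ)
when-extensional F-ext P-ext σ≗τ = cong₂ _when_ (F-ext σ≗τ) (P-ext σ≗τ)

∷-cong : ∀ b {σ τ : Vector Bool k} → σ ≗ τ → (b V.∷ σ) ≗ (b V.∷ τ)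
∷-cong b σ≗τ zero    = refl
∷-cong b σ≗τ (suc j) = σ≗τ j

_[_]≔_ : Vector Bool k → Fin k → Bool → Vector Bool k
σ [ a ]≔ x = updateAt σ a (const x)

≔-cong : ∀ a x {σ τ : Vector Bool k} → σ ≗ τ → σ [ a ]≔ x ≗ τ [ a ]≔ x
≔-cong a x {σ} {τ} σ≗τ j with j Fin.≟ a
... | yes refl = trans (updateAt-updates a σ) (sym (updateAt-updates a τ))
... | no j≢a   = trans (updateAt-minimal j a σ j≢a) (trans (σ≗τ j) (sym (updateAt-minimal j a τ j≢a)))

≔-other : ∀ {a v : Fin k} (σ : Vector Bool k) x → a ≢ v → (σ [ v ]≔ x) a ≡ σ a
≔-other {a = a} {v} σ x a≢v = updateAt-minimal a v σ a≢v

Independent : {B : Set} → Fin k → (Vector Bool k → B) → Set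
Independent a F = ∀ σ x → F (σ [ a ]≔ x) ≡ F σ

when-independent : ∀ {v : Fin k} {F : Vector Bool k → ℚ} {P : Vector Bool k → Bool} →
                   Independent v F → Independent v P → Independent v (λ σ → F σ when P σ)
when-independent F⊥v P⊥v σ x = cong₂ _when_ (F⊥v σ x) (P⊥v σ x)

pair-independent : ∀ (g : Bool → Bool → Bool) {a b v : Fin k} → a ≢ v → b ≢ v → Independent v (λ σ → g (σ a) (σ b))
pair-independent g a≢v b≢v σ x = cong₂ g (≔-other σ x a≢v) (≔-other σ x b≢v)

flipAt : Fin k → Vector Bool k → Vector Bool k
flipAt a σ = updateAt σ a not

flipAt-zero : ∀ b (σ : Vector Bool k) → (not b V.∷ σ) ≗ flipAt zero (b V.∷ σ)
flipAt-zero b σ zero    = refl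
flipAt-zero b σ (suc j) = refl

flipAt-suc : ∀ b a (σ : Vector Bool k) → (b V.∷ flipAt a σ) ≗ flipAt (suc a) (b V.∷ σ)
flipAt-suc b a σ zero    = refl
flipAt-suc b a σ (suc j) = refl

∑-flipAt : {F : Vector Bool k → ℚ} → Extensional F → ∀ a → ∑ F ≡ ∑ (F ∘ flipAt a)
∑-flipAt {F = F} F-ext zero = begin
  ∑ F                                                   ≡⟨ ∑-suc F ⟩
  ∑ (λ σ → F (false V.∷ σ) + F (true V.∷ σ))            ≡⟨ ∑-cong (λ σ → ℚ.+-comm (F (false V.∷ σ)) _) ⟩
  ∑ (λ σ → F (true V.∷ σ) + F (false V.∷ σ))            ≡⟨ ∑-cong (λ σ → cong₂ _+_ (F-ext (flipAt-zero false σ))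
                                                                                  (F-ext (flipAt-zero true σ))) ⟩
  ∑ (λ σ → F (flipAt zero (false V.∷ σ)) + F (flipAt zero (true V.∷ σ))) ≡⟨ ∑-suc (F ∘ flipAt zero) ⟨
  ∑ (F ∘ flipAt zero)                                   ∎
  where open ≡-Reasoning
∑-flipAt {F = F} F-ext (suc a) = begin
  ∑ F                                                   ≡⟨ ∑-suc F ⟩
  ∑ G                                                   ≡⟨ ∑-flipAt G-ext a ⟩
  ∑ (G ∘ flipAt a)                                      ≡⟨ ∑-cong (λ σ → cong₂ _+_ (F-ext (flipAt-suc false a σ))
                                                                                  (F-ext (flipAt-suc true a σ))) ⟩
  ∑ (λ σ → F (flipAt (suc a) (false V.∷ σ)) + F (flipAt (suc a) (true V.∷ σ))) ≡⟨ ∑-suc (F ∘ flipAt (suc a)) ⟨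
  ∑ (F ∘ flipAt (suc a))                                ∎
  where
  open ≡-Reasoning
  G : Vector Bool _ → ℚ
  G σ = F (false V.∷ σ) + F (true V.∷ σ)
  G-ext : Extensional G
  G-ext σ≗τ = cong₂ _+_ (F-ext (∷-cong false σ≗τ)) (F-ext (∷-cong true σ≗τ))

pairedAt : Fin k → (Vector Bool k → ℚ) → Vector Bool k → ℚ
pairedAt a F σ = (F σ + F (σ [ a ]≔ true)) when not (σ a)

pairedAt-extensional : ∀ a {F : Vector Bool k → ℚ} → Extensional F → Extensional (pairedAt a F)
pairedAt-extensional a F-ext σ≗τ =
  cong₂ _when_ (cong₂ _+_ (F-ext σ≗τ) (F-ext (≔-cong a true σ≗τ))) (cong not (σ≗τ a))

∑-pairedAt : ∀ a {F : Vector Bool k → ℚ} → Extensional F → ∑ F ≡ ∑ (pairedAt a F)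
∑-pairedAt a {F} F-ext = begin
  ∑ F                                   ≡⟨ ∑-cong (λ σ → when-split (F σ) (σ a)) ⟩
  ∑ (λ σ → A σ + B σ)                   ≡⟨ ∑-+ A B ⟩
  ∑ A + ∑ B                             ≡⟨ cong (∑ A +_) (∑-flipAt B-ext a) ⟩
  ∑ A + ∑ (B ∘ flipAt a)                ≡⟨ cong (∑ A +_) (∑-cong flipped) ⟩
  ∑ A + ∑ A′                            ≡⟨ ∑-+ A A′ ⟨
  ∑ (λ σ → A σ + A′ σ)                  ≡⟨ ∑-cong (λ σ → when-+ (F σ) _ (not (σ a))) ⟩
  ∑ (pairedAt a F)                      ∎
  where
  open ≡-Reasoning
  A B A′ : Vector Bool _ → ℚ
  A σ = F σ when not (σ a)
  B σ = F σ when σ a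
  A′ σ = F (σ [ a ]≔ true) when not (σ a)
  B-ext : Extensional B
  B-ext = when-extensional F-ext (λ σ≗τ → σ≗τ a)
  flipped : ∀ σ → B (flipAt a σ) ≡ F (σ [ a ]≔ true) when not (σ a)
  flipped σ with σ a in σa
  ... | true  = cong (F (flipAt a σ) when_) (trans (updateAt-updates a σ) (cong not σa))
  ... | false = cong₂ _when_ (F-ext (updateAt-cong-local a σ (cong not σa)))
                             (trans (updateAt-updates a σ) (cong not σa))

term≤∑ : {F : Vector Bool k → ℚ} → Extensional F → (∀ σ → 0ℚ ≤ F σ) → ∀ σ → F σ ≤ ∑ F
term≤∑ {zero} {F} F-ext F≥0 σ = ℚ.≤-reflexive (trans (F-ext (λ ())) (sym (trans (∑-zero F) (ℚ.+-identityʳ _))))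
term≤∑ {suc k} {F} F-ext F≥0 σ = begin
  F σ                                        ≡⟨ F-ext head∷tail ⟩
  F (σ zero V.∷ V.tail σ)                    ≤⟨ ≤-pair (σ zero) ⟩
  G (V.tail σ)                               ≤⟨ term≤∑ G-ext G≥0 (V.tail σ) ⟩
  ∑ G                                        ≡⟨ ∑-suc F ⟨
  ∑ F                                        ∎
  where
  open ℚ.≤-Reasoning
  G : Vector Bool k → ℚ
  G τ = F (false V.∷ τ) + F (true V.∷ τ)
  G-ext : Extensional G
  G-ext τ≗τ′ = cong₂ _+_ (F-ext (∷-cong false τ≗τ′)) (F-ext (∷-cong true τ≗τ′))
  G≥0 : ∀ τ → 0ℚ ≤ G τ
  G≥0 τ = ℚ.+-mono-≤ (F≥0 _) (F≥0 _)
  head∷tail : σ ≗ (σ zero V.∷ V.tail σ)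
  head∷tail zero    = refl
  head∷tail (suc j) = refl
  ≤-pair : ∀ b → F (b V.∷ V.tail σ) ≤ G (V.tail σ)
  ≤-pair false = ℚ.≤-trans (ℚ.≤-reflexive (sym (ℚ.+-identityʳ _)))
                           (ℚ.+-monoʳ-≤ (F (false V.∷ V.tail σ)) (F≥0 (true V.∷ V.tail σ)))
  ≤-pair true  = ℚ.≤-trans (ℚ.≤-reflexive (sym (ℚ.+-identityˡ _)))
                           (ℚ.+-monoˡ-≤ (F (true V.∷ V.tail σ)) (F≥0 (false V.∷ V.tail σ)))

pairedAt-constraint : ∀ {F : Vector Bool k → ℚ} (g : Bool → Bool → Bool) {a b} → a ≢ b →
                      Independent a F → Independent b F → ∀ σ →
                      pairedAt b (pairedAt a (λ τ → F τ when g (τ a) (τ b))) σ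
                        ≡ count g * F σ when (not (σ a) ∧ not (σ b))
pairedAt-constraint {F = F} g {a} {b} a≢b F⊥a F⊥b σ = by-cases (σ a) (σ b) refl refl
  where
  G K : Vector Bool _ → ℚ
  G τ = F τ when g (τ a) (τ b)
  K = pairedAt a G
  σ′ : Vector Bool _
  σ′ = σ [ b ]≔ true
  G-at : ∀ τ {x y} → τ a ≡ x → τ b ≡ y → F τ ≡ F σ → G τ ≡ F σ when g x y
  G-at τ τa τb Fτ = cong₂ _when_ Fτ (cong₂ g τa τb)
  by-cases : ∀ x y → σ a ≡ x → σ b ≡ y → pairedAt b K σ ≡ count g * F σ when (not (σ a) ∧ not (σ b))
  by-cases x true σa σb = trans (when-false (cong not σb))
    (sym (trans (cong (count g *_) (when-false (trans (cong (λ t → not (σ a) ∧ not t) σb) (∧-zeroʳ _))))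
                (ℚ.*-zeroʳ (count g))))
  by-cases true false σa σb = begin
    pairedAt b K σ                ≡⟨ when-true (cong not σb) ⟩
    K σ + K σ′                    ≡⟨ cong₂ _+_ (when-false (cong not σa))
                                               (when-false (cong not (trans (≔-other σ true a≢b) σa))) ⟩
    0ℚ + 0ℚ                       ≡⟨ trans (ℚ.+-identityʳ 0ℚ) (sym (ℚ.*-zeroʳ (count g))) ⟩
    count g * 0ℚ                  ≡⟨ cong (count g *_) (when-false (cong (λ t → not t ∧ not (σ b)) σa)) ⟨
    count g * F σ when (not (σ a) ∧ not (σ b)) ∎
    where open ≡-Reasoning
  by-cases false false σa σb = begin
    pairedAt b K σ                                                ≡⟨ when-true (cong not σb) ⟩
    K σ + K σ′                                                    ≡⟨ cong₂ _+_ Kσ Kσ′ ⟩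
    (F σ when g false false + F σ when g true false)
      + (F σ when g false true + F σ when g true true)           ≡⟨ when-count g (F σ) ⟩
    count g * F σ                                                 ≡⟨ cong (count g *_) (when-true both-unset) ⟨
    count g * F σ when (not (σ a) ∧ not (σ b))                   ∎
    where
    open ≡-Reasoning
    both-unset : not (σ a) ∧ not (σ b) ≡ true
    both-unset = cong₂ (λ s t → not s ∧ not t) σa σb
    Kσ : K σ ≡ F σ when g false false + F σ when g true false
    Kσ = trans (when-true (cong not σa))
               (cong₂ _+_ (G-at σ σa σb refl)
                          (G-at (σ [ a ]≔ true) (updateAt-updates a σ) (trans (≔-other σ true (a≢b ∘ sym)) σb)
                                (F⊥a σ true)))
    Kσ′ : K σ′ ≡ F σ when g false true + F σ when g true true
    Kσ′ = trans (when-true (cong not (trans (≔-other σ true a≢b) σa)))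
                (cong₂ _+_ (G-at σ′ (trans (≔-other σ true a≢b) σa) (updateAt-updates b σ) (F⊥b σ true))
                           (G-at (σ′ [ a ]≔ true) (updateAt-updates a σ′)
                                 (trans (≔-other σ′ true (a≢b ∘ sym)) (updateAt-updates b σ))
                                 (trans (F⊥a σ′ true) (F⊥b σ true))))

∑-pair : ∀ {F : Vector Bool k → ℚ} (g : Bool → Bool → Bool) {a b} → a ≢ b →
         Extensional F → Independent a F → Independent b F →
         ∑ (λ σ → F σ when g (σ a) (σ b)) ≡ count g * ∑ (λ σ → F σ when (not (σ a) ∧ not (σ b)))
∑-pair {F = F} g {a} {b} a≢b F-ext F⊥a F⊥b = begin
  ∑ G                                                    ≡⟨ ∑-pairedAt a G-ext ⟩
  ∑ (pairedAt a G)                                       ≡⟨ ∑-pairedAt b (pairedAt-extensional a G-ext) ⟩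
  ∑ (pairedAt b (pairedAt a G))                          ≡⟨ ∑-cong (pairedAt-constraint g a≢b F⊥a F⊥b) ⟩
  ∑ (λ σ → count g * F σ when (not (σ a) ∧ not (σ b)))  ≡⟨ ∑-* (count g) _ ⟩
  count g * ∑ (λ σ → F σ when (not (σ a) ∧ not (σ b)))  ∎
  where
  open ≡-Reasoning
  G : Vector Bool _ → ℚ
  G σ = F σ when g (σ a) (σ b)
  G-ext : Extensional G
  G-ext = when-extensional F-ext (λ σ≗τ → cong₂ g (σ≗τ a) (σ≗τ b))

-- Sums under disjoint pair constraints

Constraint : ℕ → Set
Constraint k = Fin k × Fin k × (Bool → Bool → Bool)

satisfies : List (Constraint k) → Vector Bool k → Bool
satisfies []                 σ = true
satisfies ((a , b , g) ∷ cs) σ = g (σ a) (σ b) ∧ satisfies cs σ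

coordinates : List (Constraint k) → List (Fin k)
coordinates []                 = []
coordinates ((a , b , _) ∷ cs) = a ∷ b ∷ coordinates cs

unset : List (Constraint k) → Vector Bool k → Bool
unset cs σ = all (not ∘ σ) (coordinates cs)

countAll : List (Constraint k) → ℚ
countAll []                 = 1ℚ
countAll ((_ , _ , g) ∷ cs) = count g * countAll cs

satisfies-elim : ∀ {cs : List (Constraint k)} {σ} → satisfies cs σ ≡ true →
                 ∀ {a b g} → (a , b , g) ∈ cs → g (σ a) (σ b) ≡ true
satisfies-elim {cs = (a , b , g) ∷ cs} {σ} sat (here refl) = ∧-conicalˡ (g (σ a) (σ b)) _ sat
satisfies-elim {cs = (a , b , g) ∷ cs} {σ} sat (there c∈) = satisfies-elim (∧-conicalʳ (g (σ a) (σ b)) _ sat) c∈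

satisfies-intro : ∀ (cs : List (Constraint k)) {σ} →
                  (∀ {a b g} → (a , b , g) ∈ cs → g (σ a) (σ b) ≡ true) → satisfies cs σ ≡ true
satisfies-intro []                 holds = refl
satisfies-intro ((a , b , g) ∷ cs) holds = cong₂ _∧_ (holds (here refl)) (satisfies-intro cs (holds ∘ there))

unset-extensional : ∀ (cs : List (Constraint k)) → Extensional (unset cs)
unset-extensional cs σ≗τ = all-cong (coordinates cs) (λ {v} _ → cong not (σ≗τ v))

unset-independent : ∀ (cs : List (Constraint k)) {v} → v ∉ coordinates cs → Independent v (unset cs)
unset-independent cs v∉ σ x = all-cong (coordinates cs) (λ a∈ → cong not (≔-other σ x (λ a≡v → v∉ (subst (_∈ _) a≡v a∈))))

∑-constraints : ∀ (cs : List (Constraint k)) {F : Vector Bool k → ℚ} →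
                Unique (coordinates cs) → Extensional F → (∀ {v} → v ∈ coordinates cs → Independent v F) →
                ∑ (λ σ → F σ when satisfies cs σ) ≡ countAll cs * ∑ (λ σ → F σ when unset cs σ)
∑-constraints [] {F} _ _ _ = sym (ℚ.*-identityˡ (∑ F))
∑-constraints ((a , b , g) ∷ cs) {F} u@(_ ∷ u′@(_ ∷ u″)) F-ext F⊥ = begin
  ∑ (λ σ → F σ when (g (σ a) (σ b) ∧ satisfies cs σ))
    ≡⟨ ∑-cong (λ σ → trans (when-∧ (F σ) _ (satisfies cs σ)) (when-comm (F σ) (satisfies cs σ) (g (σ a) (σ b)))) ⟩
  ∑ (λ σ → F′ σ when satisfies cs σ)
    ≡⟨ ∑-constraints cs u″ F′-ext F′⊥ ⟩
  countAll cs * ∑ (λ σ → F′ σ when unset cs σ)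
    ≡⟨ cong (countAll cs *_) (∑-cong (λ σ → when-comm (F σ) (g (σ a) (σ b)) (unset cs σ))) ⟩
  countAll cs * ∑ (λ σ → F″ σ when g (σ a) (σ b))
    ≡⟨ cong (countAll cs *_) (∑-pair g a≢b F″-ext F″⊥a F″⊥b) ⟩
  countAll cs * (count g * ∑ (λ σ → F″ σ when (not (σ a) ∧ not (σ b))))
    ≡⟨ ℚ.*-assoc (countAll cs) (count g) _ ⟨
  (countAll cs * count g) * ∑ (λ σ → F″ σ when (not (σ a) ∧ not (σ b)))
    ≡⟨ cong₂ _*_ (ℚ.*-comm (countAll cs) (count g)) (∑-cong regroup) ⟩
  (count g * countAll cs) * ∑ (λ σ → F σ when (not (σ a) ∧ (not (σ b) ∧ unset cs σ))) ∎
  where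
  open ≡-Reasoning
  a∉ : a ∉ b ∷ coordinates cs
  a∉ = Unique[x∷xs]⇒x∉xs u
  b∉ : b ∉ coordinates cs
  b∉ = Unique[x∷xs]⇒x∉xs u′
  a≢b : a ≢ b
  a≢b = a∉ ∘ here
  F′ F″ : Vector Bool _ → ℚ
  F′ σ = F σ when g (σ a) (σ b)
  F″ σ = F σ when unset cs σ
  F′-ext : Extensional F′
  F′-ext = when-extensional F-ext (λ σ≗τ → cong₂ g (σ≗τ a) (σ≗τ b))
  F″-ext : Extensional F″
  F″-ext = when-extensional F-ext (unset-extensional cs)
  F′⊥ : ∀ {v} → v ∈ coordinates cs → Independent v F′
  F′⊥ v∈ = when-independent {P = λ σ → g (σ a) (σ b)} (F⊥ (there (there v∈)))
             (pair-independent g (λ a≡v → a∉ (there (subst (_∈ _) (sym a≡v) v∈)))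
                                 (λ b≡v → b∉ (subst (_∈ _) (sym b≡v) v∈)))
  regroup : ∀ σ → F″ σ when (not (σ a) ∧ not (σ b)) ≡ F σ when (not (σ a) ∧ (not (σ b) ∧ unset cs σ))
  regroup σ = trans (when-∧ (F″ σ) (not (σ a)) (not (σ b)))
                    (sym (trans (when-∧ (F σ) (not (σ a)) _) (cong (_when not (σ a)) (when-∧ (F σ) (not (σ b)) _))))
  F″⊥a : Independent a F″
  F″⊥a = when-independent (F⊥ (here refl)) (unset-independent cs (a∉ ∘ there))
  F″⊥b : Independent b F″
  F″⊥b = when-independent (F⊥ (there (here refl))) (unset-independent cs b∉)

-- Trees

module Tree (H : BTG) (wf : WellFormed H) where
  open BTG H

  root-inT : ∀ i → InT H i (root i)
  root-inT = wf .proj₁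

  par-root : ∀ i → par i (root i) ≡ root i
  par-root = wf .proj₂ .proj₁

  par-inT : ∀ i v → InT H i v → InT H i (par i v)
  par-inT = wf .proj₂ .proj₂ .proj₁

  reaches-root : ∀ i v → InT H i v → ∃ λ t → iter H i t v ≡ root i
  reaches-root = wf .proj₂ .proj₂ .proj₂ .proj₁

  leaf-no-sibling : ∀ i v w → IsLeaf H i v → ¬ TreeSib H i v w
  leaf-no-sibling = wf .proj₂ .proj₂ .proj₂ .proj₂ .proj₂ .proj₁

  leaf-of-two-trees : ∀ i v → IsLeaf H i v →
                      ∃ λ j → j ≢ i × IsLeaf H j v × (∀ k → IsLeaf H k v → k ≡ i ⊎ k ≡ j)
  leaf-of-two-trees = wf .proj₂ .proj₂ .proj₂ .proj₂ .proj₂ .proj₂ .proj₁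

  shared-leaves : ∀ i j → i ≢ j → ∀ v → InT H i v → InT H j v → IsLeaf H i v × IsLeaf H j v
  shared-leaves = wf .proj₂ .proj₂ .proj₂ .proj₂ .proj₂ .proj₂ .proj₂ .proj₂ .proj₁

  iter-+ : ∀ i s t v → iter H i (s ℕ.+ t) v ≡ iter H i s (iter H i t v)
  iter-+ i zero    t v = refl
  iter-+ i (suc s) t v = cong (par i) (iter-+ i s t v)

  iter-inT : ∀ i v t → InT H i v → InT H i (iter H i t v)
  iter-inT i v zero    v∈ = v∈
  iter-inT i v (suc t) v∈ = par-inT i _ (iter-inT i v t v∈)

  -- By pigeonhole, any iterate of the parent map is already reached within n steps.
  iter-bounded : ∀ i v t → ∃ λ (s : Fin n) → iter H i (toℕ s) v ≡ iter H i t v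
  iter-bounded i v = <-rec (λ t → ∃ λ (s : Fin n) → iter H i (toℕ s) v ≡ iter H i t v) step
    where
    step : ∀ t → (∀ {t′} → t′ ℕ.< t → ∃ λ (s : Fin n) → iter H i (toℕ s) v ≡ iter H i t′ v) →
           ∃ λ (s : Fin n) → iter H i (toℕ s) v ≡ iter H i t v
    step t shorter with t ℕ.<? n
    ... | yes t<n = Fin.fromℕ< t<n , cong (λ s → iter H i s v) (Fin.toℕ-fromℕ< t<n)
    ... | no t≮n with Fin.pigeonhole (ℕ.n<1+n n) (λ (s : Fin (suc n)) → iter H i (toℕ s) v)
    ...   | s₁ , s₂ , s₁<s₂ , loop = map₂ (λ e → trans e shortcut) (shorter t′<t)
      where
      s₂≤t : toℕ s₂ ℕ.≤ t
      s₂≤t = ℕ.≤-trans (ℕ.<⇒≤pred (Fin.toℕ<n s₂)) (ℕ.≮⇒≥ t≮n)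
      t′ : ℕ
      t′ = (t ∸ toℕ s₂) ℕ.+ toℕ s₁
      t′<t : t′ ℕ.< t
      t′<t = subst (t′ ℕ.<_) (ℕ.m∸n+n≡m s₂≤t) (ℕ.+-monoʳ-< (t ∸ toℕ s₂) s₁<s₂)
      shortcut : iter H i t′ v ≡ iter H i t v
      shortcut = begin
        iter H i t′ v                                    ≡⟨ iter-+ i (t ∸ toℕ s₂) (toℕ s₁) v ⟩
        iter H i (t ∸ toℕ s₂) (iter H i (toℕ s₁) v)      ≡⟨ cong (iter H i (t ∸ toℕ s₂)) loop ⟩
        iter H i (t ∸ toℕ s₂) (iter H i (toℕ s₂) v)      ≡⟨ iter-+ i (t ∸ toℕ s₂) (toℕ s₂) v ⟨
        iter H i ((t ∸ toℕ s₂) ℕ.+ toℕ s₂) v               ≡⟨ cong (λ s → iter H i s v) (ℕ.m∸n+n≡m s₂≤t) ⟩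
        iter H i t v                                     ∎
        where open ≡-Reasoning

  Ancestor : Fin m → Fin n → Fin n → Set
  Ancestor i ℓ v = ∃ λ t → iter H i t ℓ ≡ v

  ancᵇ-elim : ∀ i ℓ v → ancᵇ H i ℓ v ≡ true → Ancestor i ℓ v
  ancᵇ-elim i ℓ v e with anyFin-witness {n} (λ s → eqᵇ H (iter H i (toℕ s) ℓ) v) e
  ... | s , e′ = toℕ s , eqᵇ-≡ e′

  ancᵇ-intro : ∀ i ℓ v → Ancestor i ℓ v → ancᵇ H i ℓ v ≡ true
  ancᵇ-intro i ℓ v (t , reach) with iter-bounded i ℓ t
  ... | s , same = anyFin-intro {n} (λ s → eqᵇ H (iter H i (toℕ s) ℓ) v) s
                     (subst (λ w → eqᵇ H (iter H i (toℕ s) ℓ) w ≡ true) (trans same reach) (eqᵇ-refl _))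

  HalfPath : Fin m → Fin m → Fin n → Set
  HalfPath i j v = ∃ λ ℓ → InT H i ℓ × InT H j ℓ × Ancestor i ℓ v

  halfᵇ-elim : ∀ i j v → halfᵇ H i j v ≡ true → HalfPath i j v
  halfᵇ-elim i j v e with anyFin-witness {n} (λ ℓ → sharedᵇ H i j ℓ ∧ ancᵇ H i ℓ v) e
  ... | ℓ , e′ with ∧-true e′
  ...   | shared , anc = ℓ , proj₁ (∧-true shared) , proj₂ (∧-true shared) , ancᵇ-elim i ℓ v anc

  halfᵇ-intro : ∀ i j v → HalfPath i j v → halfᵇ H i j v ≡ true
  halfᵇ-intro i j v (ℓ , ℓ∈i , ℓ∈j , anc) =
    anyFin-intro {n} (λ ℓ → sharedᵇ H i j ℓ ∧ ancᵇ H i ℓ v) ℓ (cong₂ _∧_ (cong₂ _∧_ ℓ∈i ℓ∈j) (ancᵇ-intro i ℓ v anc))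

  halfPath-inT : ∀ {i j v} → HalfPath i j v → InT H i v
  halfPath-inT {i} (ℓ , ℓ∈i , _ , t , reach) = subst (InT H i) reach (iter-inT i ℓ t ℓ∈i)

  root-on-halfPath : ∀ i j → PE H i j → HalfPath i j (root i)
  root-on-halfPath i j (_ , ℓ , ℓ∈i , ℓ∈j) = ℓ , ℓ∈i , ℓ∈j , reaches-root i ℓ ℓ∈i

  inT-root : ∀ {i k v} → InT H i v → v ≡ root k → k ≡ i
  inT-root {i} {k} {v} v∈i v≡root with k Fin.≟ i
  ... | yes k≡i = k≡i
  ... | no k≢i  = contradiction v≡root
                    (proj₁ (proj₂ (proj₁ (shared-leaves k i k≢i v (subst (InT H k) (sym v≡root) (root-inT k)) v∈i))))

  root-injective : ∀ {a b} → root a ≡ root b → a ≡ b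
  root-injective {a} ra≡rb = sym (inT-root (root-inT a) ra≡rb)

  leaf-not-root : ∀ {i v} → IsLeaf H i v → ¬ IsRootVar H v
  leaf-not-root leaf (k , v≡root) with inT-root (proj₁ leaf) v≡root
  ... | refl = proj₁ (proj₂ leaf) v≡root

  leaf-not-proper-ancestor : ∀ {i ℓ v} → IsLeaf H i ℓ → InT H i v → ∀ t → iter H i (suc t) v ≢ ℓ
  leaf-not-proper-ancestor {i} {ℓ} {v} leaf v∈i t reach with iter H i t v Fin.≟ root i
  ... | yes at-root = proj₁ (proj₂ leaf) (trans (sym reach) (trans (cong (par i) at-root) (par-root i)))
  ... | no not-root = proj₂ (proj₂ leaf) (iter H i t v) (iter-inT i v t v∈i) not-root reach

  shared-leaf : ∀ {i j} → i ≢ j → ∀ {v} → InT H i v → InT H j v → IsLeaf H i v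
  shared-leaf i≢j v∈i v∈j = proj₁ (shared-leaves _ _ i≢j _ v∈i v∈j)

  -- T_i meets T_p and T_j in different leaves, since a leaf lies in only two trees.
  shared-leaves-distinct : ∀ {i p j ℓ ℓ′} → p ≢ j → i ≢ p → i ≢ j →
                           InT H i ℓ → InT H p ℓ → InT H i ℓ′ → InT H j ℓ′ → ℓ ≢ ℓ′
  shared-leaves-distinct {i} {p} {j} {ℓ} p≢j i≢p i≢j ℓ∈i ℓ∈p ℓ∈i′ ℓ∈j refl
    with leaf-of-two-trees i ℓ (shared-leaf i≢p ℓ∈i ℓ∈p)
  ... | q , _ , _ , only with only p (shared-leaves i p i≢p ℓ ℓ∈i ℓ∈p .proj₂)
                            | only j (shared-leaves i j i≢j ℓ ℓ∈i′ ℓ∈j .proj₂)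
  ...   | inj₁ p≡i | _        = i≢p (sym p≡i)
  ...   | inj₂ _   | inj₁ j≡i = i≢j (sym j≡i)
  ...   | inj₂ p≡q | inj₂ j≡q = p≢j (trans p≡q (sym j≡q))

  treeSib-sym : ∀ {i c c′} → TreeSib H i c c′ → TreeSib H i c′ c
  treeSib-sym (c∈ , c′∈ , c≢r , c′≢r , c≢c′ , same-par) = c′∈ , c∈ , c′≢r , c≢r , c≢c′ ∘ sym , sym same-par

  treeSib-internal : ∀ {i c c′} → TreeSib H i c c′ → IsInternal H c
  treeSib-internal {i} {c} {c′} sib@(c∈ , _ , c≢r , _) = not-root , not-leaf
    where
    not-root : ¬ IsRootVar H c
    not-root (k , c≡root) with inT-root c∈ c≡root
    ... | refl = c≢r c≡root
    not-leaf : ¬ IsLeafVar H c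
    not-leaf (k , leaf) with k Fin.≟ i
    ... | yes refl = leaf-no-sibling i c c′ leaf sib
    ... | no k≢i   = leaf-no-sibling i c c′ (shared-leaves k i k≢i c (proj₁ leaf) c∈ .proj₂) sib

  -- Climbing from ℓ to the first ancestor u that is also an ancestor of ℓ′, the last
  -- vertices below u on the two paths are siblings.
  diverging-siblings : ∀ {i ℓ ℓ′} → IsLeaf H i ℓ → IsLeaf H i ℓ′ → ℓ ≢ ℓ′ →
                       ∃ λ c → ∃ λ c′ → TreeSib H i c c′ × Ancestor i ℓ c × Ancestor i ℓ′ c′
  diverging-siblings {i} {ℓ} {ℓ′} leaf leaf′ ℓ≢ℓ′
    with reaches-root i ℓ (proj₁ leaf)
  ... | K , ℓ-root
    with least (λ s → ancᵇ H i ℓ′ (iter H i s ℓ)) K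
               (ancᵇ-intro i ℓ′ _ (subst (Ancestor i ℓ′) (sym ℓ-root) (reaches-root i ℓ′ (proj₁ leaf′))))
  ... | zero , common , _ with ancᵇ-elim i ℓ′ _ common
  ...   | zero  , ℓ′≡ℓ = contradiction (sym ℓ′≡ℓ) ℓ≢ℓ′
  ...   | suc t , reach = contradiction reach (leaf-not-proper-ancestor leaf (proj₁ leaf′) t)
  diverging-siblings {i} {ℓ} {ℓ′} leaf leaf′ ℓ≢ℓ′ | K , ℓ-root | suc k₀ , common , below
    with ancᵇ-elim i ℓ′ _ common
  ... | t , reach
    with least (λ s → eqᵇ H (iter H i s ℓ′) (iter H i (suc k₀) ℓ)) t
               (subst (λ w → eqᵇ H w (iter H i (suc k₀) ℓ) ≡ true) (sym reach) (eqᵇ-refl _))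
  ... | zero , meet , _ = contradiction (sym (eqᵇ-≡ meet)) (leaf-not-proper-ancestor leaf′ (proj₁ leaf) k₀)
  ... | suc t₀ , meet , below′ =
        c , c′ , (iter-inT i ℓ k₀ (proj₁ leaf) , iter-inT i ℓ′ t₀ (proj₁ leaf′) , c≢root , c′≢root , c≢c′ , sym par-c′)
          , (k₀ , refl) , (t₀ , refl)
    where
    c c′ u : Fin n
    c  = iter H i k₀ ℓ
    c′ = iter H i t₀ ℓ′
    u  = iter H i (suc k₀) ℓ
    par-c′ : par i c′ ≡ u
    par-c′ = eqᵇ-≡ meet
    c-not-common : ancᵇ H i ℓ′ c ≡ false
    c-not-common = below k₀ (ℕ.n<1+n k₀)
    c≢c′ : c ≢ c′
    c≢c′ c≡c′ = contradiction (trans (sym (ancᵇ-intro i ℓ′ c (t₀ , sym c≡c′))) c-not-common) λ ()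
    c≢root : c ≢ root i
    c≢root c≡root = contradiction
      (trans (sym (ancᵇ-intro i ℓ′ c (subst (Ancestor i ℓ′) (sym c≡root) (reaches-root i ℓ′ (proj₁ leaf′)))))
             c-not-common) λ ()
    c′≢root : c′ ≢ root i
    c′≢root c′≡root = contradiction
      (trans (sym (subst (λ w → eqᵇ H c′ w ≡ true) c′≡u (eqᵇ-refl c′))) (below′ t₀ (ℕ.n<1+n t₀))) λ ()
      where
      c′≡u : c′ ≡ u
      c′≡u = trans c′≡root (trans (sym (par-root i)) (trans (cong (par i) (sym c′≡root)) par-c′))

-- Clauses

module Clauses (H : BTG) (wf : WellFormed H) where
  open BTG H
  open Tree H wf

  clauseᵇ-elim : ∀ {i j v} → clauseᵇ H i j v ≡ true → HalfPath i j v ⊎ HalfPath j i v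
  clauseᵇ-elim {i} {j} {v} c with ∨-true {halfᵇ H i j v} c
  ... | inj₁ h = inj₁ (halfᵇ-elim i j v h)
  ... | inj₂ h = inj₂ (halfᵇ-elim j i v h)

  clauseᵇ-left : ∀ {i j v} → HalfPath i j v → clauseᵇ H i j v ≡ true
  clauseᵇ-left {i} {j} {v} h = cong (_∨ halfᵇ H j i v) (halfᵇ-intro i j v h)

  clauseᵇ-right : ∀ {i j v} → HalfPath j i v → clauseᵇ H i j v ≡ true
  clauseᵇ-right {i} {j} {v} h = ∨-trueʳ (halfᵇ H i j v) (halfᵇ-intro j i v h)

  clauseᵇ-sym : ∀ i j v → clauseᵇ H i j v ≡ clauseᵇ H j i v
  clauseᵇ-sym i j v = ∨-comm (halfᵇ H i j v) (halfᵇ H j i v)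

  clause-root : ∀ {i j v k} → clauseᵇ H i j v ≡ true → v ≡ root k → k ≡ i ⊎ k ≡ j
  clause-root c v≡root with clauseᵇ-elim c
  ... | inj₁ h = inj₁ (inT-root (halfPath-inT h) v≡root)
  ... | inj₂ h = inj₂ (inT-root (halfPath-inT h) v≡root)

  pe-sym : ∀ {i j} → PE H i j → PE H j i
  pe-sym (i≢j , v , v∈i , v∈j) = i≢j ∘ sym , v , v∈j , v∈i

  isPEᵇ-elim : ∀ {i j} → isPEᵇ H i j ≡ true → PE H i j
  isPEᵇ-elim {i} {j} e with ∧-true e
  ... | distinct , meet with anyFin-witness {n} (sharedᵇ H i j) meet
  ...   | v , shared = (λ i≡j → contradiction (trans (sym distinct) (cong not (subst (λ x → eqᵇ H i x ≡ true) i≡j (eqᵇ-refl i)))) λ ())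
                     , v , proj₁ (∧-true shared) , proj₂ (∧-true shared)

  isPEᵇ-intro : ∀ {i j} → PE H i j → isPEᵇ H i j ≡ true
  isPEᵇ-intro {i} {j} (i≢j , v , v∈i , v∈j) =
    cong₂ _∧_ (cong not (eqᵇ-≢ i≢j)) (anyFin-intro {n} (sharedᵇ H i j) v (cong₂ _∧_ v∈i v∈j))

  rootConstraint : (Bool → Bool → Bool) → Fin m × Fin m → Constraint n
  rootConstraint g (i , j) = root i , root j , g

  respects-sym : ∀ {S i j} → Respects H S i j → Respects H S j i
  respects-sym {S} {i} {j} (nonroots-false , siblings-true) =
      (λ v c → nonroots-false v (trans (clauseᵇ-sym i j v) c))
    , (λ v w c → siblings-true v w (trans (clauseᵇ-sym i j v) c))

-- Extensions of a comfortable assignment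

module Comfortable (H : BTG) (wf : WellFormed H)
  (M : List (Fin (BTG.m H) × Fin (BTG.m H))) (pm : IsPM H M)
  (S : PartialAssignment H) (free⇔matched : ∀ v → (S v ≡ nothing) ⇔ InUM H M v)
  (comf : Comfortable1 H M S) where
  open BTG H
  open Tree H wf
  open Clauses H wf

  record Matched (i p : Fin m) : Set where
    field
      pseudoedge : PE H i p
      respected  : Respects H S i p
      listed     : (i , p) ∈ M ⊎ (p , i) ∈ M

  open Matched

  matched : ∀ {e} → e ∈ M → Matched (proj₁ e) (proj₂ e)
  matched e∈M = record
    { pseudoedge = All.lookup (proj₁ pm) e∈M
    ; respected  = All.lookup (proj₂ comf) e∈M
    ; listed     = inj₁ e∈M
    }

  matched-sym : ∀ {i p} → Matched i p → Matched p i
  matched-sym mt = record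
    { pseudoedge = pe-sym (pseudoedge mt)
    ; respected  = respects-sym (respected mt)
    ; listed     = Sum.swap (listed mt)
    }

  nonroot-false : ∀ {i p v} → Matched i p → clauseᵇ H i p v ≡ true → ¬ IsRootVar H v → S v ≡ just false
  nonroot-false mt = proj₁ (respected mt) _

  sibling-true : ∀ {i p v w} → Matched i p → clauseᵇ H i p v ≡ true → IsInternal H v → Sib H v w → S w ≡ just true
  sibling-true mt = proj₂ (respected mt) _ _

  free-root-matched : ∀ {i} → S (root i) ≡ nothing → ∃ (Matched i)
  free-root-matched {i} free with Equivalence.to (free⇔matched (root i)) free
  ... | e , e∈M , inj₁ r with root-injective r
  ...   | refl = proj₂ e , matched e∈M
  free-root-matched {i} free | e , e∈M , inj₂ r with root-injective r
  ...   | refl = proj₁ e , matched-sym (matched e∈M)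

  free⇒root : ∀ {v} → S v ≡ nothing → IsRootVar H v
  free⇒root {v} free with Equivalence.to (free⇔matched v) free
  ... | e , _ , inj₁ r = proj₁ e , r
  ... | e , _ , inj₂ r = proj₂ e , r

  nonroot-assigned : ∀ {v} → ¬ IsRootVar H v → ∃ λ b → S v ≡ just b
  nonroot-assigned {v} not-root with S v in Sv
  ... | just b  = b , refl
  ... | nothing = contradiction (free⇒root Sv) not-root

  free-in-clause : ∀ {i j w} → clauseᵇ H i j w ≡ true → S w ≡ nothing →
                   S (root i) ≡ nothing ⊎ S (root j) ≡ nothing
  free-in-clause c free with free⇒root free
  ... | k , w≡root with clause-root c w≡root
  ...   | inj₁ refl = inj₁ (subst (λ x → S x ≡ nothing) w≡root free)
  ...   | inj₂ refl = inj₂ (subst (λ x → S x ≡ nothing) w≡root free)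

  -- The paths to ℓ_{i,p} and ℓ_{i,j} split at siblings c, c′; respecting {t_i, t_p} sets c′ to true.
  true-sibling-on-halfPath : ∀ {i p j} → Matched i p → PE H i j → p ≢ j →
                             ∃ λ c′ → HalfPath i j c′ × S c′ ≡ just true × IsInternal H c′
  true-sibling-on-halfPath {i} {p} {j} mt (i≢j , ℓ′ , ℓ′∈i , ℓ′∈j) p≢j
    with pseudoedge mt
  ... | i≢p , ℓ , ℓ∈i , ℓ∈p
    with diverging-siblings (shared-leaf i≢p ℓ∈i ℓ∈p) (shared-leaf i≢j ℓ′∈i ℓ′∈j)
                            (shared-leaves-distinct p≢j i≢p i≢j ℓ∈i ℓ∈p ℓ′∈i ℓ′∈j)
  ... | c , c′ , sib , c-anc , c′-anc =
        c′ , (ℓ′ , ℓ′∈i , ℓ′∈j , c′-anc)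
           , sibling-true mt (clauseᵇ-left (ℓ , ℓ∈i , ℓ∈p , c-anc)) (treeSib-internal sib)
                         (treeSib-internal sib , treeSib-internal (treeSib-sym sib) , i , sib)
           , treeSib-internal (treeSib-sym sib)

  ec-agrees : ∀ {σ} → ECᵇ H S σ ≡ true → ∀ {v b} → S v ≡ just b → σ v ≡ b
  ec-agrees {σ} ec {v} Sv with S v | allFin-elim {n} _ ec v
  ... | just b | agrees with Sv
  ...   | refl with b Bool.≟ σ v
  ...     | yes b≡σv = sym b≡σv

  ec-intro : ∀ {τ} → (∀ {v b} → S v ≡ just b → τ v ≡ b) → ECᵇ H S τ ≡ true
  ec-intro {τ} agrees with ECᵇ H S τ in ec
  ... | true  = refl
  ... | false with all-false-witness _ (allFin n) ec
  ...   | v , disagrees with S v in Sv | disagrees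
  ...     | nothing | d = contradiction d λ ()
  ...     | just b  | d with b Bool.≟ τ v
  ...       | yes _   = contradiction d λ ()
  ...       | no b≢τv = contradiction (sym (agrees Sv)) b≢τv

  ec-transfer : ∀ {σ τ} → (∀ v → S v ≡ nothing ⊎ σ v ≡ τ v) → ECᵇ H S σ ≡ true → ECᵇ H S τ ≡ true
  ec-transfer {σ} {τ} same-on-assigned ec = ec-intro agrees
    where
    agrees : ∀ {v b} → S v ≡ just b → τ v ≡ b
    agrees {v} Sv with same-on-assigned v
    ... | inj₁ free = contradiction (trans (sym Sv) free) λ ()
    ... | inj₂ σv≡τv = trans (sym σv≡τv) (ec-agrees ec Sv)

  ecᵇ-cong : ∀ {σ τ} → (∀ v → S v ≡ nothing ⊎ σ v ≡ τ v) → ECᵇ H S σ ≡ ECᵇ H S τ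
  ecᵇ-cong same-on-assigned =
    bool-ext (ec-transfer same-on-assigned) (ec-transfer (Sum.map₂ sym ∘ same-on-assigned))

  module Extension {σ : Assignment H} (ec : ECᵇ H S σ ≡ true) where

    true-halfPath-vertex : ∀ {i p v} → Matched i p → HalfPath i p v → σ v ≡ true → σ (root i) ≡ true
    true-halfPath-vertex {i} {p} {v} mt h σv with σ (root i) in σti
    ... | true  = refl
    ... | false = contradiction (trans (sym σv) (ec-agrees ec (nonroot-false mt (clauseᵇ-left h) not-root))) λ ()
      where
      not-root : ¬ IsRootVar H v
      not-root (k , v≡root) with inT-root (halfPath-inT h) v≡root
      ... | refl = contradiction (trans (sym σv) (trans (cong σ v≡root) σti)) λ ()

    true-clause-vertex : ∀ {i p v} → Matched i p → clauseᵇ H i p v ≡ true → σ v ≡ true →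
                         σ (root i) ∨ σ (root p) ≡ true
    true-clause-vertex {i} {p} mt c σv with clauseᵇ-elim c
    ... | inj₁ h = cong (_∨ σ (root p)) (true-halfPath-vertex mt h σv)
    ... | inj₂ h = ∨-trueʳ (σ (root i)) (true-halfPath-vertex (matched-sym mt) h σv)

    matched-disjunction : satisfies (map (rootConstraint _∨_) M) σ ≡ true →
                          ∀ {i p} → Matched i p → σ (root i) ∨ σ (root p) ≡ true
    matched-disjunction sat {i} {p} mt with listed mt
    ... | inj₁ ip∈M = satisfies-elim sat (∈-map⁺ (rootConstraint _∨_) ip∈M)
    ... | inj₂ pi∈M = trans (∨-comm (σ (root i)) (σ (root p))) (satisfies-elim sat (∈-map⁺ (rootConstraint _∨_) pi∈M))

    free-root-clause : satisfies (map (rootConstraint _∨_) M) σ ≡ true → ∀ {i j} → PE H i j →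
                       (∀ v → clauseᵇ H i j v ≡ true → σ v ≡ false) → ¬ S (root i) ≡ nothing
    free-root-clause sat {i} {j} pe all-false free with free-root-matched free
    ... | p , mt with p Fin.≟ j
    ...   | yes refl = contradiction
              (trans (sym (matched-disjunction sat mt))
                     (cong₂ _∨_ (all-false (root i) (clauseᵇ-left {i} {p} (root-on-halfPath i p pe)))
                                (all-false (root p) (clauseᵇ-right {i} {p} (root-on-halfPath p i (pe-sym pe))))))
              λ ()
    ...   | no p≢j =
      let c′ , h , Sc′ , _ = true-sibling-on-halfPath mt pe p≢j
      in contradiction (trans (sym (ec-agrees ec Sc′)) (all-false c′ (clauseᵇ-left {i} {j} h))) λ ()

    -- A clause falsified by σ would either have a free end, handled by the matching, or be
    -- fully assigned and falsified by S itself.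
    no-false-clause : satisfies (map (rootConstraint _∨_) M) σ ≡ true → ∀ {i j} → PE H i j →
                      ¬ (∀ v → clauseᵇ H i j v ≡ true → σ v ≡ false)
    no-false-clause sat {i} {j} pe all-false with S (root i) in Sti | S (root j) in Stj
    ... | nothing | _       = free-root-clause sat pe all-false Sti
    ... | just _  | nothing = free-root-clause sat (pe-sym pe) (λ v c → all-false v (trans (clauseᵇ-sym i j v) c)) Stj
    ... | just _  | just _  = proj₁ comf i j pe S-false
      where
      S-false : ∀ v → clauseᵇ H i j v ≡ true → S v ≡ just false
      S-false v c with S v in Sv
      ... | just b  = cong just (trans (sym (ec-agrees ec Sv)) (all-false v c))
      ... | nothing with free-in-clause c Sv
      ...   | inj₁ free = contradiction (trans (sym Sti) free) λ ()
      ...   | inj₂ free = contradiction (trans (sym Stj) free) λ ()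

    satHᵇ≡disjunctions : satHᵇ H σ ≡ satisfies (map (rootConstraint _∨_) M) σ
    satHᵇ≡disjunctions = bool-ext to from
      where
      to : satHᵇ H σ ≡ true → satisfies (map (rootConstraint _∨_) M) σ ≡ true
      to sat = satisfies-intro (map (rootConstraint _∨_) M) holds
        where
        holds : ∀ {a b g} → (a , b , g) ∈ map (rootConstraint _∨_) M → g (σ a) (σ b) ≡ true
        holds c∈ with ∈-map⁻ (rootConstraint _∨_) c∈
        ... | (i , p) , ip∈M , refl with anyFin-witness {n} (λ v → clauseᵇ H i p v ∧ σ v)
              (subst (λ x → not x ∨ anyFin H (λ v → clauseᵇ H i p v ∧ σ v) ≡ true)
                     (isPEᵇ-intro (pseudoedge (matched ip∈M)))
                     (allFin-elim {m} _ (allFin-elim {m} _ sat i) p))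
        ...   | v , clause-true = true-clause-vertex (matched ip∈M) (proj₁ (∧-true clause-true))
                                                                    (proj₂ (∧-true clause-true))
      from : satisfies (map (rootConstraint _∨_) M) σ ≡ true → satHᵇ H σ ≡ true
      from sat = allFin-intro {m} _ λ i → allFin-intro {m} _ λ j → pseudoedge-satisfied i j
        where
        pseudoedge-satisfied : ∀ i j → not (isPEᵇ H i j) ∨ anyFin H (λ v → clauseᵇ H i j v ∧ σ v) ≡ true
        pseudoedge-satisfied i j with isPEᵇ H i j in isPE
        ... | false = refl
        ... | true with anyFin H (λ v → clauseᵇ H i j v ∧ σ v) in witnessed
        ...   | true  = refl
        ...   | false = contradiction all-false (no-false-clause sat (isPEᵇ-elim isPE))
          where
          all-false : ∀ v → clauseᵇ H i j v ≡ true → σ v ≡ false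
          all-false v c = subst (λ x → x ∧ σ v ≡ false) c (anyFin-false {n} _ witnessed v)

    halfClause≡root : ∀ {i p} → Matched i p → anyFin H (λ v → halfᵇ H i p v ∧ σ v) ≡ σ (root i)
    halfClause≡root {i} {p} mt = bool-ext to from
      where
      to : anyFin H (λ v → halfᵇ H i p v ∧ σ v) ≡ true → σ (root i) ≡ true
      to e with anyFin-witness {n} (λ v → halfᵇ H i p v ∧ σ v) e
      ... | v , on-path = true-halfPath-vertex mt (halfᵇ-elim i p v (proj₁ (∧-true on-path))) (proj₂ (∧-true on-path))
      from : σ (root i) ≡ true → anyFin H (λ v → halfᵇ H i p v ∧ σ v) ≡ true
      from σti = anyFin-intro {n} (λ v → halfᵇ H i p v ∧ σ v) (root i)
                   (cong₂ _∧_ (halfᵇ-intro i p (root i) (root-on-halfPath i p (pseudoedge mt))) σti)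

  FixedBy : Assignment H → Fin m → Fin m → Fin n → Set
  FixedBy σ i j v = PE H i j × InT H i v × InT H j v × σ v ≡ true
                  × (∀ w → clauseᵇ H i j w ≡ true → w ≢ v → σ w ≡ false)

  fixᵇ-elim : ∀ {σ v} → fixᵇ H σ v ≡ true → ∃ λ i → ∃ λ j → FixedBy σ i j v
  fixᵇ-elim {σ} {v} fix =
    let σv , witnessed        = ∧-true fix
        i , at-i               = anyFin-witness {m} _ witnessed
        j , at-ij              = anyFin-witness {m} _ at-i
        isPE , rest            = ∧-true at-ij
        shared , others-false = ∧-true rest
    in i , j , isPEᵇ-elim isPE , proj₁ (∧-true shared) , proj₂ (∧-true shared) , σv
     , false-elsewhere i j (allFin-elim {n} _ others-false)
    where
    false-elsewhere : ∀ i j → (∀ w → not (clauseᵇ H i j w) ∨ (eqᵇ H w v ∨ not (σ w)) ≡ true) →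
                      ∀ w → clauseᵇ H i j w ≡ true → w ≢ v → σ w ≡ false
    false-elsewhere i j others-false w c w≢v = trans (sym (not-involutive (σ w))) (cong not not-σw)
      where
      not-σw : not (σ w) ≡ true
      not-σw = subst (λ x → x ∨ not (σ w) ≡ true) (eqᵇ-≢ w≢v)
                 (subst (λ x → not x ∨ (eqᵇ H w v ∨ not (σ w)) ≡ true) c (others-false w))

  fixᵇ-intro : ∀ {σ i j v} → FixedBy σ i j v → fixᵇ H σ v ≡ true
  fixᵇ-intro {σ} {i} {j} {v} (pe , v∈i , v∈j , σv , false-elsewhere) =
    cong₂ _∧_ σv (anyFin-intro {m} _ i (anyFin-intro {m} _ j
      (cong₂ _∧_ (isPEᵇ-intro pe) (cong₂ _∧_ (cong₂ _∧_ v∈i v∈j) (allFin-intro {n} _ others-false)))))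
    where
    others-false : ∀ w → not (clauseᵇ H i j w) ∨ (eqᵇ H w v ∨ not (σ w)) ≡ true
    others-false w with clauseᵇ H i j w in c | w Fin.≟ v
    ... | false | _       = refl
    ... | true  | yes _   = refl
    ... | true  | no w≢v  = cong not (false-elsewhere w c w≢v)

  -- With t_i free, its matching partner p either is j (so ℓ_{i,j} is forced false by S) or
  -- gives a true sibling on P^{1/2}_{i→j}; both contradict v ∈ Fix(σ).
  fixed-root-assigned : ∀ {σ i j v} → ECᵇ H S σ ≡ true → FixedBy σ i j v → ¬ S (root i) ≡ nothing
  fixed-root-assigned {σ} {i} {j} {v} ec (pe , v∈i , v∈j , σv , false-elsewhere) free
    with free-root-matched free
  ... | p , mt with p Fin.≟ j
  ...   | yes refl = contradiction
          (trans (sym σv) (ec-agrees ec (nonroot-false mt (clauseᵇ-left (v , v∈i , v∈j , 0 , refl))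
                                                        (leaf-not-root (shared-leaf (proj₁ pe) v∈i v∈j)))))
          λ ()
  ...   | no p≢j =
    let c′ , h , Sc′ , internal = true-sibling-on-halfPath mt pe p≢j
        c′≢v : c′ ≢ v
        c′≢v c′≡v = proj₂ internal (i , subst (IsLeaf H i) (sym c′≡v) (shared-leaf (proj₁ pe) v∈i v∈j))
    in contradiction (trans (sym (ec-agrees ec Sc′)) (false-elsewhere c′ (clauseᵇ-left {i} {j} h) c′≢v)) λ ()

  fixedBy-transfer : ∀ {σ τ i j v} → ECᵇ H S σ ≡ true → ECᵇ H S τ ≡ true → FixedBy σ i j v → FixedBy τ i j v
  fixedBy-transfer {σ} {τ} {i} {j} {v} ecσ ecτ fixed@(pe , v∈i , v∈j , σv , false-elsewhere) =
    pe , v∈i , v∈j , τv , τ-false-elsewhere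
    where
    same-if-assigned : ∀ {w b} → S w ≡ just b → τ w ≡ σ w
    same-if-assigned Sw = trans (ec-agrees ecτ Sw) (sym (ec-agrees ecσ Sw))
    τv : τ v ≡ true
    τv = trans (same-if-assigned (proj₂ (nonroot-assigned (leaf-not-root (shared-leaf (proj₁ pe) v∈i v∈j))))) σv
    fixed-sym : FixedBy σ j i v
    fixed-sym = pe-sym pe , v∈j , v∈i , σv , λ w c → false-elsewhere w (trans (clauseᵇ-sym i j w) c)
    τ-false-elsewhere : ∀ w → clauseᵇ H i j w ≡ true → w ≢ v → τ w ≡ false
    τ-false-elsewhere w c w≢v = by-status (S w) refl
      where
      by-status : ∀ s → S w ≡ s → τ w ≡ false
      by-status (just _) Sw = trans (same-if-assigned Sw) (false-elsewhere w c w≢v)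
      by-status nothing  Sw = Sum.[ (λ free → contradiction free (fixed-root-assigned ecσ fixed))
                                  , (λ free → contradiction free (fixed-root-assigned ecσ fixed-sym)) ]′
                                  (free-in-clause c Sw)

  fixᵇ-cong : ∀ {σ τ} → ECᵇ H S σ ≡ true → ECᵇ H S τ ≡ true → ∀ v → fixᵇ H σ v ≡ fixᵇ H τ v
  fixᵇ-cong ecσ ecτ v = bool-ext (transfer ecσ ecτ) (transfer ecτ ecσ)
    where
    transfer : ∀ {σ τ} → ECᵇ H S σ ≡ true → ECᵇ H S τ ≡ true → fixᵇ H σ v ≡ true → fixᵇ H τ v ≡ true
    transfer ecσ ecτ fix = let _ , _ , fixed = fixᵇ-elim fix in fixᵇ-intro (fixedBy-transfer ecσ ecτ fixed)

-- Counting

*-pos : ∀ {p q} → 0ℚ < p → 0ℚ < q → 0ℚ < p * q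
*-pos {p} {q} 0<p 0<q = ℚ.positive⁻¹ (p * q) {{ℚ.pos*pos⇒pos p {{positive 0<p}} q {{positive 0<q}}}}

halfPow-pos : ∀ k → 0ℚ < halfPow k
halfPow-pos zero    = ℚ.positive⁻¹ 1ℚ
halfPow-pos (suc k) = *-pos (ℚ.positive⁻¹ ½) (halfPow-pos k)

module Counting (H : BTG) (wf : WellFormed H)
  (M : List (Fin (BTG.m H) × Fin (BTG.m H))) (pm : IsPM H M)
  (S : PartialAssignment H) (free⇔matched : ∀ v → (S v ≡ nothing) ⇔ InUM H M v)
  (comf : Comfortable1 H M S) where
  open BTG H
  open Tree H wf
  open Clauses H wf
  open Comfortable H wf M pm S free⇔matched comf

  σ₀ : Assignment H
  σ₀ v = fromMaybe false (S v)

  σ₀-ec : ECᵇ H S σ₀ ≡ true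
  σ₀-ec = ec-intro (cong (fromMaybe false))

  w₀ : ℚ
  w₀ = weight H σ₀

  w₀-pos : 0ℚ < w₀
  w₀-pos = halfPow-pos (n ∸ countFix H σ₀)

  weight-on-EC : ∀ {σ} → ECᵇ H S σ ≡ true → weight H σ ≡ w₀
  weight-on-EC ec = cong (λ c → halfPow (n ∸ c)) (length-filter-cong (allFin n) (fixᵇ-cong ec σ₀-ec))

  uniform : Assignment H → ℚ
  uniform σ = w₀ when ECᵇ H S σ

  uniform-extensional : Extensional uniform
  uniform-extensional σ≗τ = cong (w₀ when_) (ecᵇ-cong (inj₂ ∘ σ≗τ))

  uniform-independent : ∀ {v} → S v ≡ nothing → Independent v uniform
  uniform-independent {v} free σ x = cong (w₀ when_) (ecᵇ-cong unchanged)
    where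
    unchanged : ∀ w → S w ≡ nothing ⊎ (σ [ v ]≔ x) w ≡ σ w
    unchanged w with w Fin.≟ v
    ... | yes refl = inj₁ free
    ... | no w≢v   = inj₂ (updateAt-minimal w v σ w≢v)

  Pr-on-EC : ∀ (A P : Assignment H → Bool) → (∀ {σ} → ECᵇ H S σ ≡ true → satHᵇ H σ ∧ A σ ≡ P σ) →
             Pr H (λ σ → A σ ∧ ECᵇ H S σ) ≡ ∑ (λ σ → uniform σ when P σ)
  Pr-on-EC A P on-EC = trans (sym (∑-unfold _)) (∑-cong pointwise)
    where
    pointwise : ∀ σ → weight H σ when (satHᵇ H σ ∧ (A σ ∧ ECᵇ H S σ)) ≡ uniform σ when P σ
    pointwise σ with ECᵇ H S σ in ec
    ... | true  = cong₂ _when_ (weight-on-EC ec) (trans (cong (satHᵇ H σ ∧_) (∧-identityʳ (A σ))) (on-EC ec))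
    ... | false = trans (cong (weight H σ when_) (trans (cong (satHᵇ H σ ∧_) (∧-zeroʳ (A σ))) (∧-zeroʳ (satHᵇ H σ))))
                        (sym (0-when (P σ)))

  choices : ∀ {L φ} → InCNF H L φ → List (Constraint n)
  choices []                                = []
  choices {L = (i , j) ∷ _} (inj₁ _ ∷ ps) = (root i , root j , λ x _ → x) ∷ choices ps
  choices {L = (i , j) ∷ _} (inj₂ _ ∷ ps) = (root i , root j , λ _ y → y) ∷ choices ps

  coordinates-choices : ∀ {L φ} (ps : InCNF H L φ) →
                        coordinates (choices ps) ≡ coordinates (map (rootConstraint _∨_) L)
  coordinates-choices []                                = refl
  coordinates-choices {L = (i , j) ∷ _} (inj₁ _ ∷ ps) = cong (λ cs → root i ∷ root j ∷ cs) (coordinates-choices ps)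
  coordinates-choices {L = (i , j) ∷ _} (inj₂ _ ∷ ps) = cong (λ cs → root i ∷ root j ∷ cs) (coordinates-choices ps)

  coordinates-rootConstraints : ∀ g L → coordinates (map (rootConstraint g) L) ≡ map root (ends H L)
  coordinates-rootConstraints g []            = refl
  coordinates-rootConstraints g ((i , j) ∷ L) = cong (λ vs → root i ∷ root j ∷ vs) (coordinates-rootConstraints g L)

  ∈-coordinates : ∀ g L {v} → v ∈ coordinates (map (rootConstraint g) L) → InUM H L v
  ∈-coordinates g (e ∷ L) (here v≡)         = e , here refl , inj₁ v≡
  ∈-coordinates g (e ∷ L) (there (here v≡)) = e , here refl , inj₂ v≡
  ∈-coordinates g (e ∷ L) (there (there v∈)) =
    let e′ , e′∈L , at-end = ∈-coordinates g L v∈ in e′ , there e′∈L , at-end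

  countAll-disjunctions-pos : ∀ L → 0ℚ < countAll (map (rootConstraint _∨_) L)
  countAll-disjunctions-pos []      = ℚ.positive⁻¹ 1ℚ
  countAll-disjunctions-pos (_ ∷ L) = *-pos (ℚ.positive⁻¹ (count _∨_)) (countAll-disjunctions-pos L)

  -- Each clause of φ has 2 of the 3 satisfying assignments of its matched pair of roots.
  countAll-choices : ∀ {L φ} (ps : InCNF H L φ) →
                     countAll (choices ps) ≡ twoThirdsPow (length L) * countAll (map (rootConstraint _∨_) L)
  countAll-choices []                                = refl
  countAll-choices {L = (i , j) ∷ L} (inj₁ _ ∷ ps) =
    trans (cong (count (λ x _ → x) *_) (countAll-choices ps))
          (*-interchange (ℤ.+ 2 / 3) (count _∨_) (twoThirdsPow (length L)) _)
  countAll-choices {L = (i , j) ∷ L} (inj₂ _ ∷ ps) =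
    trans (cong (count (λ _ y → y) *_) (countAll-choices ps))
          (*-interchange (ℤ.+ 2 / 3) (count _∨_) (twoThirdsPow (length L)) _)

  choices⇒disjunctions : ∀ {L φ} (ps : InCNF H L φ) {σ} → satisfies (choices ps) σ ≡ true →
                         satisfies (map (rootConstraint _∨_) L) σ ≡ true
  choices⇒disjunctions []                                  sat = refl
  choices⇒disjunctions {L = (i , j) ∷ L} (inj₁ _ ∷ ps) {σ} sat =
    let σi , rest = ∧-true sat in cong₂ _∧_ (cong (_∨ σ (root j)) σi) (choices⇒disjunctions ps rest)
  choices⇒disjunctions {L = (i , j) ∷ L} (inj₂ _ ∷ ps) {σ} sat =
    let σj , rest = ∧-true sat in cong₂ _∧_ (∨-trueʳ (σ (root i)) σj) (choices⇒disjunctions ps rest)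

  module _ {σ : Assignment H} (ec : ECᵇ H S σ ≡ true) where
    open Extension ec

    ESᵇ≡choices : ∀ {L φ} (ps : InCNF H L φ) → (∀ {e} → e ∈ L → e ∈ M) → ESᵇ H φ σ ≡ satisfies (choices ps) σ
    ESᵇ≡choices []                                       L⊆M = refl
    ESᵇ≡choices {L = (i , j) ∷ _} (inj₁ refl ∷ ps) L⊆M =
      cong₂ _∧_ (halfClause≡root (matched (L⊆M (here refl)))) (ESᵇ≡choices ps (L⊆M ∘ there))
    ESᵇ≡choices {L = (i , j) ∷ _} (inj₂ refl ∷ ps) L⊆M =
      cong₂ _∧_ (halfClause≡root (matched-sym (matched (L⊆M (here refl))))) (ESᵇ≡choices ps (L⊆M ∘ there))

  disjunctions : List (Constraint n)
  disjunctions = map (rootConstraint _∨_) M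

  coordinates-unique : Unique (coordinates disjunctions)
  coordinates-unique = subst Unique (sym (coordinates-rootConstraints _∨_ M)) (map⁺ root-injective (proj₂ pm))

  coordinate-free : ∀ {v} → v ∈ coordinates disjunctions → S v ≡ nothing
  coordinate-free {v} v∈ = Equivalence.from (free⇔matched v) (∈-coordinates _∨_ M v∈)

  mass : ℚ
  mass = ∑ (λ σ → uniform σ when unset disjunctions σ)

  mass-pos : 0ℚ < mass
  mass-pos = ℚ.<-≤-trans (subst (0ℚ <_) (sym at-σ₀) w₀-pos)
                         (term≤∑ (when-extensional uniform-extensional (unset-extensional disjunctions)) nonneg σ₀)
    where
    at-σ₀ : uniform σ₀ when unset disjunctions σ₀ ≡ w₀
    at-σ₀ = cong₂ _when_ (cong (w₀ when_) σ₀-ec)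
                         (all-intro _ (coordinates disjunctions) (cong (not ∘ fromMaybe false) ∘ coordinate-free))
    nonneg : ∀ σ → 0ℚ ≤ uniform σ when unset disjunctions σ
    nonneg σ with ECᵇ H S σ | unset disjunctions σ
    ... | true  | true  = ℚ.<⇒≤ w₀-pos
    ... | true  | false = ℚ.≤-refl
    ... | false | true  = ℚ.≤-refl
    ... | false | false = ℚ.≤-refl

  Pr-EC : Pr H (ECᵇ H S) ≡ countAll disjunctions * mass
  Pr-EC = trans (Pr-on-EC (λ _ → true) (satisfies disjunctions)
                          (λ ec → trans (∧-identityʳ _) (Extension.satHᵇ≡disjunctions ec)))
                (∑-constraints disjunctions coordinates-unique uniform-extensional
                               (uniform-independent ∘ coordinate-free))

  Pr-ES-EC : ∀ {φ} (ps : InCNF H M φ) →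
             Pr H (λ σ → ESᵇ H φ σ ∧ ECᵇ H S σ) ≡ countAll (choices ps) * mass
  Pr-ES-EC {φ} ps = begin
    Pr H (λ σ → ESᵇ H φ σ ∧ ECᵇ H S σ)
      ≡⟨ Pr-on-EC (ESᵇ H φ) (satisfies (choices ps)) on-EC ⟩
    ∑ (λ σ → uniform σ when satisfies (choices ps) σ)
      ≡⟨ ∑-constraints (choices ps) (subst Unique (sym same-coordinates) coordinates-unique) uniform-extensional
                       (uniform-independent ∘ coordinate-free ∘ subst (_ ∈_) same-coordinates) ⟩
    countAll (choices ps) * ∑ (λ σ → uniform σ when unset (choices ps) σ)
      ≡⟨ cong (countAll (choices ps) *_) (∑-cong (λ σ → cong (λ vs → uniform σ when all (not ∘ σ) vs) same-coordinates)) ⟩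
    countAll (choices ps) * mass ∎
    where
    open ≡-Reasoning
    same-coordinates : coordinates (choices ps) ≡ coordinates disjunctions
    same-coordinates = coordinates-choices ps
    on-EC : ∀ {σ} → ECᵇ H S σ ≡ true → satHᵇ H σ ∧ ESᵇ H φ σ ≡ satisfies (choices ps) σ
    on-EC ec = trans (cong₂ _∧_ (Extension.satHᵇ≡disjunctions ec) (ESᵇ≡choices ec ps (λ e∈ → e∈)))
                     (∧-absorbʳ (choices⇒disjunctions ps))

lemma13 : (H : BTG) → IsPseudoexpander H →
    (M : List (Fin (BTG.m H) × Fin (BTG.m H))) → IsPM H M →
    (S : PartialAssignment H) →
    (∀ v → (S v ≡ nothing) ⇔ InUM H M v) →
    Comfortable1 H M S →
    (φ : List (Fin (BTG.m H) × Fin (BTG.m H))) → InCNF H M φ →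
    (0ℚ < Pr H (ECᵇ H S))
    × (Pr H (λ σ → ESᵇ H φ σ ∧ ECᵇ H S σ) ≡ twoThirdsPow (length M) * Pr H (ECᵇ H S))
lemma13 H (wf , _) M pm S free⇔matched comf φ ps =
    subst (0ℚ <_) (sym Pr-EC) (*-pos (countAll-disjunctions-pos M) mass-pos)
  , (begin
      Pr H (λ σ → ESᵇ H φ σ ∧ ECᵇ H S σ)                          ≡⟨ Pr-ES-EC ps ⟩
      countAll (choices ps) * mass                                ≡⟨ cong (_* mass) (countAll-choices ps) ⟩
      (twoThirdsPow (length M) * countAll disjunctions) * mass    ≡⟨ ℚ.*-assoc (twoThirdsPow (length M)) _ mass ⟩
      twoThirdsPow (length M) * (countAll disjunctions * mass)    ≡⟨ cong (twoThirdsPow (length M) *_) Pr-EC ⟨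
      twoThirdsPow (length M) * Pr H (ECᵇ H S)                    ∎)
  where
  open Counting H wf M pm S free⇔matched comf
  open ≡-Reasoning
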